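{- If $F$ is a forest with $k\geq 1$ non-trivial connected components (components with at least two vertices), then ${\rm gp}(F)\geq {\rm Z}(F)+k$.
   Context: All graphs are finite and simple; a forest is an acyclic graph (possibly with isolated vertices). Zero forcing: given a set $S\subseteq V(F)$ of initially black vertices (all others white), the color-change rule turns a white vertex $y$ black if $y$ is the only white neighbor of some black vertex $x$. ${\rm Z}(F)$ is the minimum size of a set $S$ such that repeated application of the rule eventually turns all vertices black. A set $R\subseteq V(F)$ is a general position set if no three vertices of $R$ lie on a common shortest path of $F$ (vertices in different components are joined by no path); ${\rm gp}(F)$ is the maximum size of a general position set of $F$. -}

module Defs where

open import Data.Nat using (ℕ; zero; suc; _+_; _≤_)
open import Data.Fin using (Fin)
open import Data.Fin.Subset using (Subset; _∈_; ∣_∣)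
open import Data.Bool using (Bool; true; false; T)
open import Data.List using (List; []; _∷_)
open import Data.List.Relation.Unary.Unique.Propositional using (Unique)
import Data.List.Membership.Propositional as LM
open import Data.Product using (Σ; ∃; _×_; _,_)
open import Relation.Binary.PropositionalEquality using (_≡_; _≢_)
open import Relation.Nullary using (¬_)

record Graph (n : ℕ) : Set where
  field
    adj     : Fin n → Fin n → Bool
    adj-sym : ∀ u v → adj u v ≡ adj v u
    loopless : ∀ v → adj v v ≡ false

module _ {n : ℕ} (G : Graph n) where
  open Graph G

  Adj : Fin n → Fin n → Set
  Adj u v = T (adj u v)

  data Walk : Fin n → Fin n → Set where
    []  : ∀ {u} → Walk u u
    _∷_ : ∀ {u w v} → Adj u w → Walk w v → Walk u v

  walkLength : ∀ {u v} → Walk u v → ℕ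
  walkLength []      = 0
  walkLength (_ ∷ p) = suc (walkLength p)

  vertices : ∀ {u v} → Walk u v → List (Fin n)
  vertices {u} []      = u ∷ []
  vertices {u} (_ ∷ p) = u ∷ vertices p

  -- forest: no cycle, i.e. no path v0 … vm (m ≥ 2, distinct vertices)
  -- whose ends are adjacent
  Acyclic : Set
  Acyclic = ∀ u v (p : Walk u v) → Unique (vertices p) → 2 ≤ walkLength p → ¬ Adj v u

  Connected : Fin n → Fin n → Set
  Connected u v = Walk u v

  Shortest : ∀ {u v} → Walk u v → Set
  Shortest {u} {v} p = ∀ (q : Walk u v) → walkLength p ≤ walkLength q

  OnCommonGeodesic : Fin n → Fin n → Fin n → Set
  OnCommonGeodesic a b c =
    ∃ λ u → ∃ λ v → Σ (Walk u v) λ p → Shortest p ×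
      (a LM.∈ vertices p) × (b LM.∈ vertices p) × (c LM.∈ vertices p)

  IsGPSet : Subset n → Set
  IsGPSet R = ∀ a b c → a ∈ R → b ∈ R → c ∈ R →
    a ≢ b → b ≢ c → a ≢ c → ¬ OnCommonGeodesic a b c

  IsGPNumber : ℕ → Set
  IsGPNumber g = (∃ λ R → IsGPSet R × ∣ R ∣ ≡ g) ×
                 (∀ R → IsGPSet R → ∣ R ∣ ≤ g)

  -- vertices eventually black starting from S under the color-change rule
  -- (least set containing S closed under the rule)
  data Black (S : Subset n) : Fin n → Set where
    initial : ∀ {v} → v ∈ S → Black S v
    force   : ∀ {x y} → Black S x → Adj x y →
              (∀ w → Adj x w → w ≢ y → Black S w) → Black S y

  IsZeroForcingSet : Subset n → Set
  IsZeroForcingSet S = ∀ v → Black S v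

  IsZeroForcingNumber : ℕ → Set
  IsZeroForcingNumber z = (∃ λ S → IsZeroForcingSet S × ∣ S ∣ ≡ z) ×
                          (∀ S → IsZeroForcingSet S → z ≤ ∣ S ∣)

  InNontrivialComponent : Fin n → Set
  InNontrivialComponent v = ∃ λ w → w ≢ v × Connected v w

  -- G has exactly k non-trivial components: there is a set T of k
  -- representatives, one per non-trivial component
  NumNontrivialComponents : ℕ → Set
  NumNontrivialComponents k = ∃ λ (Rep : Subset n) → ∣ Rep ∣ ≡ k ×
    (∀ t → t ∈ Rep → InNontrivialComponent t) ×
    (∀ t t′ → t ∈ Rep → t′ ∈ Rep → Connected t t′ → t ≡ t′) ×
    (∀ v → InNontrivialComponent v → ∃ λ t → t ∈ Rep × Connected v t)

-- Let Low be the set of vertices of degree at most one.  No vertex of degree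
-- at most one is an inner vertex of a geodesic, so Low is a general position
-- set.  Choose one leaf in every non-trivial component; removing these k
-- leaves from Low leaves a zero forcing set: root each non-trivial tree at
-- its chosen leaf; every other leaf is black from the start, and a vertex
-- becomes black once one of its children and all of that child's children
-- are black, because the child then forces it.  Hence Z(F) ≤ |Low| - k ≤
-- gp(F) - k.
module Submission where

open import Data.Nat using (ℕ; zero; suc; _+_; _≤_; _<_; z≤n; s≤s)
open import Data.Nat.Properties
  using (≤-trans; ≤-<-trans; <-irrefl; <⇒≱; n≤1+n; +-suc; +-mono-≤; m<m+n; module ≤-Reasoning)
open import Data.Fin using (Fin; zero; suc; _≟_)
open import Data.Fin.Properties using (any?; all?; suc-injective; 0≢1+n)
open import Data.Fin.Subset using (Subset; _∈_; _∉_; ∣_∣; ⊤; _∩_; _─_; _-_; inside; outside)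
open import Data.Fin.Subset.Properties
  using (_∈?_; ∈⊤; ∣⊤∣≡n; x∈p∩q⁺; x∈p∧x∉q⇒x∈p─q; x∈p∧x≢y⇒x∈p-y; x∈p⇒∣p-x∣<∣p∣)
open import Data.Bool using (T)
open import Data.Bool.Properties using (T?)
open import Data.Vec using ([]; _∷_; here; there; tabulate)
open import Data.Vec.Properties using (lookup∘tabulate; []=⇒lookup; lookup⇒[]=)
open import Data.List using (List; []; _∷_; length)
open import Data.List.Relation.Unary.All as All using (All; []; _∷_)
open import Data.List.Relation.Unary.All.Properties using (¬Any⇒All¬)
open import Data.List.Relation.Unary.Any using (here; there)
open import Data.List.Relation.Unary.Unique.Propositional using (Unique)
open import Data.List.Relation.Unary.AllPairs using ([]; _∷_)
import Data.List.Membership.Propositional as List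
import Data.List.Membership.DecPropositional as DecList
open import Data.Product using (Σ; ∃; _×_; _,_; proj₁; proj₂)
open import Data.Sum using (_⊎_; inj₁; inj₂)
open import Data.Empty using (⊥)
open import Function using (_∘_)
open import Relation.Binary.PropositionalEquality
  using (_≡_; _≢_; refl; sym; trans; cong; subst)
open import Relation.Nullary using (Dec; yes; no; does; contradiction; _×-dec_; _→-dec_; ¬?)
open import Relation.Nullary.Decidable using (dec-true; decidable-stable)
open import Relation.Unary using (Pred; Decidable)
open import Defs

module _ {n : ℕ} where

  toSubset : ∀ {ℓ} {P : Pred (Fin n) ℓ} → Decidable P → Subset n
  toSubset P? = tabulate (does ∘ P?)

  module _ {ℓ} {P : Pred (Fin n) ℓ} (P? : Decidable P) where

    ∈-toSubset⁺ : ∀ {x} → P x → x ∈ toSubset P?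
    ∈-toSubset⁺ {x} px = lookup⇒[]= x _ (trans (lookup∘tabulate _ x) (dec-true (P? x) px))

    ∈-toSubset⁻ : ∀ {x} → x ∈ toSubset P? → P x
    ∈-toSubset⁻ {x} x∈ with P? x | trans (sym (lookup∘tabulate (does ∘ P?) x)) ([]=⇒lookup x∈)
    ... | yes px | _ = px
    ... | no _ | ()

  unique⇒length≤∣p∣ : ∀ {xs : List (Fin n)} {p : Subset n} →
                      Unique xs → All (_∈ p) xs → length xs ≤ ∣ p ∣
  unique⇒length≤∣p∣ [] [] = z≤n
  unique⇒length≤∣p∣ {x ∷ _} {p} (x∉xs ∷ unique) (x∈p ∷ xs⊆p) =
    ≤-trans (s≤s (unique⇒length≤∣p∣ unique (All.zipWith removeHead (x∉xs , xs⊆p))))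
            (x∈p⇒∣p-x∣<∣p∣ x∈p)
    where
      removeHead : ∀ {y} → x ≢ y × y ∈ p → y ∈ p - x
      removeHead (x≢y , y∈p) = x∈p∧x≢y⇒x∈p-y y∈p (x≢y ∘ sym)

  unique⇒length≤n : ∀ {xs : List (Fin n)} → Unique xs → length xs ≤ n
  unique⇒length≤n {xs} unique =
    subst (length xs ≤_) (∣⊤∣≡n n) (unique⇒length≤∣p∣ unique (All.tabulate (λ _ → ∈⊤)))

∣p─q∣+∣p∩q∣≡∣p∣ : ∀ {n} (p q : Subset n) → ∣ p ─ q ∣ + ∣ p ∩ q ∣ ≡ ∣ p ∣
∣p─q∣+∣p∩q∣≡∣p∣ []            []            = refl
∣p─q∣+∣p∩q∣≡∣p∣ (inside ∷ p)  (inside ∷ q)  = trans (+-suc _ _) (cong suc (∣p─q∣+∣p∩q∣≡∣p∣ p q))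
∣p─q∣+∣p∩q∣≡∣p∣ (inside ∷ p)  (outside ∷ q) = cong suc (∣p─q∣+∣p∩q∣≡∣p∣ p q)
∣p─q∣+∣p∩q∣≡∣p∣ (outside ∷ p) (inside ∷ q)  = ∣p─q∣+∣p∩q∣≡∣p∣ p q
∣p─q∣+∣p∩q∣≡∣p∣ (outside ∷ p) (outside ∷ q) = ∣p─q∣+∣p∩q∣≡∣p∣ p q

module _ {m n} (f : Fin m → Fin n) (p : Subset m) where

  inImage? : Decidable (λ y → ∃ λ x → x ∈ p × f x ≡ y)
  inImage? y = any? λ x → (x ∈? p) ×-dec (f x ≟ y)

  image : Subset n
  image = toSubset inImage?

  ∈-image⁺ : ∀ {x} → x ∈ p → f x ∈ image
  ∈-image⁺ {x} x∈p = ∈-toSubset⁺ inImage? (x , x∈p , refl)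

  ∈-image⁻ : ∀ {y} → y ∈ image → ∃ λ x → x ∈ p × f x ≡ y
  ∈-image⁻ = ∈-toSubset⁻ inImage?

injection⇒∣p∣≤∣q∣ : ∀ {m n} {p : Subset m} {q : Subset n} (f : Fin m → Fin n) →
                    (∀ {x} → x ∈ p → f x ∈ q) →
                    (∀ {x y} → x ∈ p → y ∈ p → f x ≡ f y → x ≡ y) → ∣ p ∣ ≤ ∣ q ∣
injection⇒∣p∣≤∣q∣ {p = []} f into injective = z≤n
injection⇒∣p∣≤∣q∣ {p = outside ∷ p} f into injective =
  injection⇒∣p∣≤∣q∣ (f ∘ suc) (into ∘ there)
    (λ x∈p y∈p → suc-injective ∘ injective (there x∈p) (there y∈p))
injection⇒∣p∣≤∣q∣ {p = inside ∷ p} {q} f into injective =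
  ≤-trans (s≤s (injection⇒∣p∣≤∣q∣ (f ∘ suc) intoRest
                 (λ x∈p y∈p → suc-injective ∘ injective (there x∈p) (there y∈p))))
          (x∈p⇒∣p-x∣<∣p∣ (into here))
  where
    intoRest : ∀ {x} → x ∈ p → f (suc x) ∈ q - f zero
    intoRest x∈p = x∈p∧x≢y⇒x∈p-y (into (there x∈p)) (0≢1+n ∘ sym ∘ injective (there x∈p) here)

no-three-distinct-in-pair : ∀ {ℓ} {A : Set ℓ} {a b c u v : A} →
  a ≡ u ⊎ a ≡ v → b ≡ u ⊎ b ≡ v → c ≡ u ⊎ c ≡ v → a ≢ b → b ≢ c → a ≢ c → ⊥
no-three-distinct-in-pair (inj₁ refl) (inj₁ refl) _ a≢b _ _ = a≢b refl
no-three-distinct-in-pair (inj₂ refl) (inj₂ refl) _ a≢b _ _ = a≢b refl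
no-three-distinct-in-pair (inj₁ refl) _ (inj₁ refl) _ _ a≢c = a≢c refl
no-three-distinct-in-pair (inj₂ refl) _ (inj₂ refl) _ _ a≢c = a≢c refl
no-three-distinct-in-pair _ (inj₁ refl) (inj₁ refl) _ b≢c _ = b≢c refl
no-three-distinct-in-pair _ (inj₂ refl) (inj₂ refl) _ b≢c _ = b≢c refl

module WalkProperties {n : ℕ} (G : Graph n) where
  open Graph G

  Adj-sym : ∀ {u v} → Adj G u v → Adj G v u
  Adj-sym {u} {v} = subst T (adj-sym u v)

  Adj⇒≢ : ∀ {u v} → Adj G u v → u ≢ v
  Adj⇒≢ {u} a refl = subst T (loopless u) a

  Adj? : ∀ u v → Dec (Adj G u v)
  Adj? u v = T? (adj u v)

  infixr 5 _++ʷ_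

  _++ʷ_ : ∀ {u v w} → Walk G u v → Walk G v w → Walk G u w
  []      ++ʷ q = q
  (e ∷ p) ++ʷ q = e ∷ (p ++ʷ q)

  reverseʷ : ∀ {u v} → Walk G u v → Walk G v u
  reverseʷ []      = []
  reverseʷ (e ∷ p) = reverseʷ p ++ʷ (Adj-sym e ∷ [])

  target∈vertices : ∀ {u v} (p : Walk G u v) → v List.∈ vertices G p
  target∈vertices []      = here refl
  target∈vertices (_ ∷ p) = there (target∈vertices p)

  IsPath : ∀ {u v} → Walk G u v → Set
  IsPath p = Unique (vertices G p)

  edge-isPath : ∀ {u v} (a : Adj G u v) → IsPath (a ∷ [])
  edge-isPath a = (Adj⇒≢ a ∷ []) ∷ [] ∷ []

  prefix : ∀ {u v x} (p : Walk G u v) → x List.∈ vertices G p → Walk G u x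
  prefix []      (here refl) = []
  prefix (_ ∷ _) (here refl) = []
  prefix (e ∷ p) (there x∈p) = e ∷ prefix p x∈p

  prefix-⊆ : ∀ {u v x y} (p : Walk G u v) (x∈p : x List.∈ vertices G p) →
             y List.∈ vertices G (prefix p x∈p) → y List.∈ vertices G p
  prefix-⊆ []      (here refl) y∈     = y∈
  prefix-⊆ (_ ∷ _) (here refl) (here refl) = here refl
  prefix-⊆ (_ ∷ p) (there x∈p) (here refl) = here refl
  prefix-⊆ (_ ∷ p) (there x∈p) (there y∈) = there (prefix-⊆ p x∈p y∈)

  prefix-isPath : ∀ {u v x} (p : Walk G u v) (x∈p : x List.∈ vertices G p) →
                  IsPath p → IsPath (prefix p x∈p)
  prefix-isPath []      (here refl) path = path
  prefix-isPath (_ ∷ _) (here refl) _    = [] ∷ []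
  prefix-isPath (_ ∷ p) (there x∈p) (u∉p ∷ path) =
    All.tabulate (All.lookup u∉p ∘ prefix-⊆ p x∈p) ∷ prefix-isPath p x∈p path

  suffix : ∀ {u v x} (p : Walk G u v) → x List.∈ vertices G p → Walk G x v
  suffix []      (here refl) = []
  suffix (e ∷ p) (here refl) = e ∷ p
  suffix (_ ∷ p) (there x∈p) = suffix p x∈p

  suffix-isPath : ∀ {u v x} (p : Walk G u v) (x∈p : x List.∈ vertices G p) →
                  IsPath p → IsPath (suffix p x∈p)
  suffix-isPath []      (here refl) path       = path
  suffix-isPath (_ ∷ _) (here refl) path       = path
  suffix-isPath (_ ∷ p) (there x∈p) (_ ∷ path) = suffix-isPath p x∈p path

  walk⇒path : ∀ {u v} → Walk G u v → Σ (Walk G u v) IsPath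
  walk⇒path []             = [] , [] ∷ []
  walk⇒path {u} (e ∷ p) with walk⇒path p
  ... | q , path with DecList._∈?_ _≟_ u (vertices G q)
  ...   | yes u∈q = suffix q u∈q , suffix-isPath q u∈q path
  ...   | no  u∉q = e ∷ q , ¬Any⇒All¬ _ u∉q ∷ path

module DegreeAtMostOne {n : ℕ} (G : Graph n) where
  open WalkProperties G

  Degree≤1 : Fin n → Set
  Degree≤1 x = ∀ w w′ → Adj G x w → Adj G x w′ → w ≡ w′

  degree≤1? : Decidable Degree≤1
  degree≤1? x = all? λ w → all? λ w′ → Adj? x w →-dec (Adj? x w′ →-dec (w ≟ w′))

  Low : Subset n
  Low = toSubset degree≤1?

  Leaf : Fin n → Set
  Leaf x = ∃ (Adj G x) × Degree≤1 x

  otherNeighbour? : ∀ v u → (∃ λ w → Adj G v w × w ≢ u) ⊎ (∀ {w} → Adj G v w → w ≡ u)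
  otherNeighbour? v u with any? (λ w → Adj? v w ×-dec ¬? (w ≟ u))
  ... | yes found = inj₁ found
  ... | no  none  = inj₂ λ {w} a → decidable-stable (w ≟ u) (λ w≢u → none (w , a , w≢u))

  onlyNeighbour⇒degree≤1 : ∀ {v u} → (∀ {w} → Adj G v w → w ≡ u) → Degree≤1 v
  onlyNeighbour⇒degree≤1 only _ _ a a′ = trans (only a) (sym (only a′))

  -- A vertex of degree at most one that is not an end of a walk is entered
  -- and left through the same neighbour, so that detour can be cut out.
  shortcut : ∀ {u v x} (p : Walk G u v) → x List.∈ vertices G p → x ≢ u → x ≢ v →
             Degree≤1 x → Σ (Walk G u v) λ q → walkLength G q < walkLength G p
  shortcut []      (here refl) x≢u _ _ = contradiction refl x≢u
  shortcut (_ ∷ _) (here refl) x≢u _ _ = contradiction refl x≢u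
  shortcut {x = x} (_∷_ {w = w} e p) (there x∈p) x≢u x≢v deg with x ≟ w
  shortcut (e ∷ [])     (there _) _ x≢v _   | yes refl = contradiction refl x≢v
  shortcut (e ∷ e′ ∷ p) (there _) _ _   deg | yes refl with deg _ _ (Adj-sym e) e′
  ... | refl = p , s≤s (n≤1+n _)
  shortcut (e ∷ p) (there x∈p) _ x≢v deg | no x≢w with shortcut p x∈p x≢w x≢v deg
  ... | q , shorter = e ∷ q , s≤s shorter

  degree≤1-onGeodesic⇒end : ∀ {u v x} (p : Walk G u v) → Shortest G p →
                            x List.∈ vertices G p → Degree≤1 x → x ≡ u ⊎ x ≡ v
  degree≤1-onGeodesic⇒end {u} {v} {x} p shortest x∈p deg with x ≟ u | x ≟ v
  ... | yes x≡u | _       = inj₁ x≡u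
  ... | no  _   | yes x≡v = inj₂ x≡v
  ... | no  x≢u | no  x≢v with shortcut p x∈p x≢u x≢v deg
  ...   | q , shorter = contradiction (≤-<-trans (shortest q) shorter) (<-irrefl refl)

  Low-isGPSet : IsGPSet G Low
  Low-isGPSet a b c a∈ b∈ c∈ a≢b b≢c a≢c (_ , _ , p , shortest , a∈p , b∈p , c∈p) =
    no-three-distinct-in-pair (end a∈p a∈) (end b∈p b∈) (end c∈p c∈) a≢b b≢c a≢c
    where
      end : ∀ {x} → x List.∈ vertices G p → x ∈ Low → _
      end x∈p x∈Low = degree≤1-onGeodesic⇒end p shortest x∈p (∈-toSubset⁻ degree≤1? x∈Low)

module Forest {n : ℕ} (G : Graph n) (acyclic : Acyclic G) where
  open WalkProperties G
  open DegreeAtMostOne G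

  neighbour-offPath : ∀ {v u r w} (e : Adj G v u) (p : Walk G u r) → IsPath (e ∷ p) →
                      Adj G v w → w ≢ u → w List.∉ vertices G (e ∷ p)
  neighbour-offPath e p path a w≢u (here refl) = Adj⇒≢ a refl
  neighbour-offPath e []       path a w≢u (there (here refl)) = w≢u refl
  neighbour-offPath e (_ ∷ _)  path a w≢u (there (here refl)) = w≢u refl
  -- The path from v to w, closed by the edge w–v, would be a cycle.
  neighbour-offPath {v} {w = w} e (e′ ∷ p) path a w≢u w∈@(there (there _)) =
    acyclic v w (prefix (e ∷ e′ ∷ p) w∈) (prefix-isPath (e ∷ e′ ∷ p) w∈ path)
            (s≤s (s≤s z≤n)) (Adj-sym a)

  -- Induction over the tree rooted at r: the branch at v pointing away from r
  -- is built from the branches at the other neighbours of v.  It is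
  -- well-founded because paths have at most n vertices.
  module _ {r : Fin n} (P : ∀ {v u} → Adj G v u → Walk G u r → Set)
           (step : ∀ {v u} (e : Adj G v u) (p : Walk G u r) → IsPath (e ∷ p) →
                   (∀ {w} (a : Adj G v w) → w ≢ u → P (Adj-sym a) (e ∷ p)) → P e p) where

    branch-ind : ∀ {v u} (e : Adj G v u) (p : Walk G u r) → IsPath (e ∷ p) → P e p
    branch-ind e p path = go n e p path (m<m+n n (s≤s z≤n))
      where
        go : ∀ fuel {v u} (e : Adj G v u) (p : Walk G u r) → IsPath (e ∷ p) →
             n < fuel + length (vertices G (e ∷ p)) → P e p
        go zero    e p path bound = contradiction (unique⇒length≤n path) (<⇒≱ bound)
        go (suc f) e p path bound = step e p path λ a w≢u →
          go f (Adj-sym a) (e ∷ p) (¬Any⇒All¬ _ (neighbour-offPath e p path a w≢u) ∷ path)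
             (subst (n <_) (sym (+-suc f _)) bound)

  leaf-beyond : ∀ {v u r} (e : Adj G v u) (p : Walk G u r) → IsPath (e ∷ p) →
                ∃ λ x → Leaf x × Walk G x r
  leaf-beyond {r = r} = branch-ind (λ _ _ → LeafReaching r) step
    where
      LeafReaching : Fin n → Set
      LeafReaching r = ∃ λ x → Leaf x × Walk G x r

      step : ∀ {v u} (e : Adj G v u) (p : Walk G u r) → IsPath (e ∷ p) →
             (∀ {w} → Adj G v w → w ≢ u → LeafReaching r) → LeafReaching r
      step {v} {u} e p _ beyond with otherNeighbour? v u
      ... | inj₁ (w , a , w≢u) = beyond a w≢u
      ... | inj₂ only          = v , ((u , e) , onlyNeighbour⇒degree≤1 only) , e ∷ p

  nearbyLeaf : ∀ t → Σ (Fin n) λ x → Walk G x t × (∃ (Adj G t) → Leaf x)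
  nearbyLeaf t with any? (Adj? t)
  ... | yes (s , a) with leaf-beyond (Adj-sym a) [] (edge-isPath (Adj-sym a))
  ...   | x , leaf , q = x , q , λ _ → leaf
  nearbyLeaf t | no isolated = t , [] , λ hasNeighbour → contradiction hasNeighbour isolated

  leafOf : Fin n → Fin n
  leafOf t = proj₁ (nearbyLeaf t)

  leafOf-walk : ∀ t → Walk G (leafOf t) t
  leafOf-walk t = proj₁ (proj₂ (nearbyLeaf t))

  leafOf-isLeaf : ∀ {t} → ∃ (Adj G t) → Leaf (leafOf t)
  leafOf-isLeaf {t} = proj₂ (proj₂ (nearbyLeaf t))

  module LeafForcing (L : Subset n)
    (L-leaves : ∀ {r} → r ∈ L → Leaf r)
    (L-separated : ∀ {r r′} → r ∈ L → r′ ∈ L → Connected G r r′ → r ≡ r′)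
    (L-covers : ∀ {v} → InNontrivialComponent G v → ∃ λ r → r ∈ L × Connected G v r) where

    black-if-degree≤1 : ∀ {v} → Degree≤1 v → v ∉ L → Black G (Low ─ L) v
    black-if-degree≤1 deg v∉L = initial (x∈p∧x∉q⇒x∈p─q (∈-toSubset⁺ degree≤1? deg) v∉L)

    module _ {r : Fin n} (r∈L : r ∈ L) where

      ChildrenBlack : Fin n → Fin n → Set
      ChildrenBlack v u = ∀ w → Adj G v w → w ≢ u → Black G (Low ─ L) w

      branch-black : ∀ {v u} (e : Adj G v u) (p : Walk G u r) → IsPath (e ∷ p) →
                     Black G (Low ─ L) v × ChildrenBlack v u
      branch-black = branch-ind (λ {v} {u} _ _ → Black G (Low ─ L) v × ChildrenBlack v u) step
        where
          step : ∀ {v u} (e : Adj G v u) (p : Walk G u r) → IsPath (e ∷ p) →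
                 (∀ {w} (a : Adj G v w) → w ≢ u → Black G (Low ─ L) w × ChildrenBlack w v) →
                 Black G (Low ─ L) v × ChildrenBlack v u
          step {v} {u} e p (v∉p ∷ _) children = black-v , λ w a w≢u → proj₁ (children a w≢u)
            where
              black-v : Black G (Low ─ L) v
              black-v with otherNeighbour? v u
              ... | inj₁ (w , a , w≢u) = force (proj₁ (children a w≢u)) (Adj-sym a) (proj₂ (children a w≢u))
              ... | inj₂ only = black-if-degree≤1 (onlyNeighbour⇒degree≤1 only)
                      (λ v∈L → All.lookup v∉p (target∈vertices p) (L-separated v∈L r∈L (e ∷ p)))

      root-black : Black G (Low ─ L) r
      root-black with L-leaves r∈L
      ... | (s , a) , _ with branch-black (Adj-sym a) [] (edge-isPath (Adj-sym a))
      ...   | black-s , children = force black-s (Adj-sym a) children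

    isZeroForcing : IsZeroForcingSet G (Low ─ L)
    isZeroForcing v with v ∈? L
    ... | yes v∈L = root-black v∈L
    ... | no  v∉L with any? (Adj? v)
    ...   | no isolated = black-if-degree≤1 (λ w _ a _ → contradiction (w , a) isolated) v∉L
    ...   | yes (s , a) with L-covers (s , Adj⇒≢ a ∘ sym , a ∷ [])
    ...     | r , r∈L , v~r with walk⇒path v~r
    ...       | []    , _    = contradiction r∈L v∉L
    ...       | e ∷ p , path = proj₁ (branch-black r∈L e p path)

  module Representatives (Rep : Subset n)
    (nontrivial : ∀ t → t ∈ Rep → InNontrivialComponent G t)
    (separated : ∀ t t′ → t ∈ Rep → t′ ∈ Rep → Connected G t t′ → t ≡ t′)
    (covers : ∀ v → InNontrivialComponent G v → ∃ λ t → t ∈ Rep × Connected G v t) where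

    rep-leafOf-isLeaf : ∀ {t} → t ∈ Rep → Leaf (leafOf t)
    rep-leafOf-isLeaf t∈Rep with nontrivial _ t∈Rep
    ... | _ , t≢t , []    = contradiction refl t≢t
    ... | _ , _   , a ∷ _ = leafOf-isLeaf (_ , a)

    leafOf-injective : ∀ {t t′} → t ∈ Rep → t′ ∈ Rep → leafOf t ≡ leafOf t′ → t ≡ t′
    leafOf-injective {t} {t′} t∈Rep t′∈Rep same = separated t t′ t∈Rep t′∈Rep
      (reverseʷ (leafOf-walk t) ++ʷ subst (λ x → Walk G x t′) (sym same) (leafOf-walk t′))

    Leaves : Subset n
    Leaves = image leafOf Rep

    Leaves-leaves : ∀ {r} → r ∈ Leaves → Leaf r
    Leaves-leaves r∈ with ∈-image⁻ leafOf Rep r∈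
    ... | t , t∈Rep , refl = rep-leafOf-isLeaf t∈Rep

    Leaves-separated : ∀ {r r′} → r ∈ Leaves → r′ ∈ Leaves → Connected G r r′ → r ≡ r′
    Leaves-separated r∈ r′∈ r~r′ with ∈-image⁻ leafOf Rep r∈ | ∈-image⁻ leafOf Rep r′∈
    ... | t , t∈Rep , refl | t′ , t′∈Rep , refl =
      cong leafOf (separated t t′ t∈Rep t′∈Rep
        (reverseʷ (leafOf-walk t) ++ʷ r~r′ ++ʷ leafOf-walk t′))

    Leaves-covers : ∀ {v} → InNontrivialComponent G v → ∃ λ r → r ∈ Leaves × Connected G v r
    Leaves-covers v-nontrivial with covers _ v-nontrivial
    ... | t , t∈Rep , v~t = leafOf t , ∈-image⁺ leafOf Rep t∈Rep , v~t ++ʷ reverseʷ (leafOf-walk t)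

    ∣Rep∣≤∣Low∩Leaves∣ : ∣ Rep ∣ ≤ ∣ Low ∩ Leaves ∣
    ∣Rep∣≤∣Low∩Leaves∣ = injection⇒∣p∣≤∣q∣ leafOf into leafOf-injective
      where
        into : ∀ {t} → t ∈ Rep → leafOf t ∈ Low ∩ Leaves
        into t∈Rep = x∈p∩q⁺ (∈-toSubset⁺ degree≤1? (proj₂ (rep-leafOf-isLeaf t∈Rep)) ,
                             ∈-image⁺ leafOf Rep t∈Rep)

    open LeafForcing Leaves Leaves-leaves Leaves-separated Leaves-covers public

proposition3p3 : ∀ {n : ℕ} (F : Graph n) → Acyclic F →
    ∀ (k z g : ℕ) → 1 ≤ k → NumNontrivialComponents F k →
    IsZeroForcingNumber F z → IsGPNumber F g → z + k ≤ g
proposition3p3 F acyclic k z g _ (Rep , ∣Rep∣≡k , nontrivial , separated , covers) (_ , z-min) (_ , g-max) =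
  begin
    z + k                               ≤⟨ +-mono-≤ (z-min _ isZeroForcing) k≤∣Low∩Leaves∣ ⟩
    ∣ Low ─ Leaves ∣ + ∣ Low ∩ Leaves ∣ ≡⟨ ∣p─q∣+∣p∩q∣≡∣p∣ Low Leaves ⟩
    ∣ Low ∣                             ≤⟨ g-max Low Low-isGPSet ⟩
    g                                   ∎
  where
    open ≤-Reasoning
    open DegreeAtMostOne F
    open Forest F acyclic
    open Representatives Rep nontrivial separated covers

    k≤∣Low∩Leaves∣ : k ≤ ∣ Low ∩ Leaves ∣
    k≤∣Low∩Leaves∣ = subst (_≤ ∣ Low ∩ Leaves ∣) ∣Rep∣≡k ∣Rep∣≤∣Low∩Leaves∣
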